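{- Let $G$ be a graph of order $n$ and let $u,v$ be two distinct vertices of $G$. Then $$\eta(G)_{u,v}+\eta(\overline{G})_{u,v}\geq 2^{n-2}.$$ The bound is attained if $u$ and $v$ belong to different connected components of $G$ or of $\overline{G}$.
   Context: $\overline{G}$ is the complement of $G$. For vertices $v_1,\dots,v_\ell$ of a graph $G$, $\eta(G)_{v_1,\dots,v_\ell}$ denotes the number of vertex subsets $S\subseteq V(G)$ with $v_1,\dots,v_\ell\in S$ such that the induced subgraph of $G$ on $S$ is connected. -}

module Defs where

open import Data.Bool using (Bool; true; false; _∧_; _∨_; not; if_then_else_; T)
open import Data.Bool.Properties using (∧-zeroʳ)
open import Data.Empty using (⊥-elim)
open import Data.Nat using (ℕ; zero; suc; _+_)
open import Data.Fin using (Fin; _≟_) renaming (zero to fz; suc to fs)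
open import Data.Fin.Subset using (Subset; ⊤)
open import Data.Vec using (Vec; []; _∷_; lookup)
open import Relation.Nullary using (yes; no)
open import Relation.Nullary.Decidable using (⌊_⌋)
open import Relation.Binary.PropositionalEquality using (_≡_; refl; sym; cong; cong₂)

record Graph (n : ℕ) : Set where
  field
    adj     : Fin n → Fin n → Bool
    adj-sym : ∀ x y → adj x y ≡ adj y x
    adj-irr : ∀ x → adj x x ≡ false
open Graph public

_==_ : ∀ {n} → Fin n → Fin n → Bool
x == y = ⌊ x ≟ y ⌋

==-sym : ∀ {n} (x y : Fin n) → (x == y) ≡ (y == x)
==-sym x y with x ≟ y | y ≟ x
... | yes _ | yes _ = refl
... | no _  | no _  = refl
... | yes p | no q  = ⊥-elim (q (sym p))
... | no p  | yes q = ⊥-elim (p (sym q))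

==-refl : ∀ {n} (x : Fin n) → (x == x) ≡ true
==-refl x with x ≟ x
... | yes _ = refl
... | no p  = ⊥-elim (p refl)

complement : ∀ {n} → Graph n → Graph n
complement G = record
  { adj     = λ x y → not (adj G x y) ∧ not (x == y)
  ; adj-sym = λ x y → cong₂ (λ a b → not a ∧ not b) (adj-sym G x y) (==-sym x y)
  ; adj-irr = λ x → irr x
  }
  where
  irr : ∀ x → (not (adj G x x) ∧ not (x == x)) ≡ false
  irr x rewrite ==-refl x = ∧-zeroʳ (not (adj G x x))

anyFin : ∀ {n} → (Fin n → Bool) → Bool
anyFin {zero}  f = false
anyFin {suc n} f = f fz ∨ anyFin (λ i → f (fs i))

allFin : ∀ {n} → (Fin n → Bool) → Bool
allFin {zero}  f = true
allFin {suc n} f = f fz ∧ allFin (λ i → f (fs i))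

-- walkIn G S k x y : there is a walk of length at most k from x to y in G
-- all of whose vertices after x lie in S (so for x ∈ S: a walk in the
-- induced subgraph G[S]).
walkIn : ∀ {n} → Graph n → Subset n → ℕ → Fin n → Fin n → Bool
walkIn G S zero    x y = x == y
walkIn G S (suc k) x y =
  (x == y) ∨ anyFin (λ z → lookup S z ∧ (adj G x z ∧ walkIn G S k z y))

-- The induced subgraph G[S] is connected: any two vertices of S are joined
-- by a walk inside G[S] (walks of length ≤ n suffice in a graph of order n).
inducedConnected : ∀ {n} → Graph n → Subset n → Bool
inducedConnected {n} G S =
  allFin (λ x → allFin (λ y →
    not (lookup S x ∧ lookup S y) ∨ walkIn G S n x y))

countSubsets : ∀ {n} → (Subset n → Bool) → ℕ
countSubsets {zero}  p = if p [] then 1 else 0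
countSubsets {suc n} p =
  countSubsets (λ S → p (true ∷ S)) + countSubsets (λ S → p (false ∷ S))

η₂ : ∀ {n} → Graph n → Fin n → Fin n → ℕ
η₂ G u v = countSubsets (λ S → lookup S u ∧ (lookup S v ∧ inducedConnected G S))

SameComponent : ∀ {n} → Graph n → Fin n → Fin n → Set
SameComponent {n} G u v = T (walkIn G ⊤ n u v)

module Submission where

-- Call graphs G and H on Fin n complementary if, for distinct
-- x and y, exactly one of them has the edge xy.  The heart of the argument
-- is the classical fact that for every vertex set S at least one of the
-- induced subgraphs G[S], H[S] is connected: if G[S] is disconnected and
-- x, y ∈ S are adjacent in G, then some w ∈ S is neither equal nor
-- adjacent to x or y, for otherwise the edge xy would dominate S and make
-- G[S] connected; then x - w - y is a path in H[S].
--
-- Every S containing u and v is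
-- counted by η(G)_{u,v} or by η(H)_{u,v}, and there are 2^(n-2) such S,
-- which gives the lower bound.  If u and v lie in different components of
-- G, no such G[S] is connected, so every such H[S] is, whence
-- η(G)_{u,v} = 0 and η(H)_{u,v} = 2^(n-2); symmetrically for H.

open import Defs
open import Data.Nat using (ℕ; _+_; _∸_; _^_; _≥_)
open import Data.Fin using (Fin)
open import Data.Product using (_×_)
open import Data.Sum using (_⊎_)
open import Relation.Nullary using (¬_)
open import Relation.Binary.PropositionalEquality using (_≡_; _≢_)

open import Data.Bool using (Bool; true; false; _∧_; _∨_; not; T; if_then_else_)
open import Data.Bool.Properties using (T-∧; T-∨; ∧-identityʳ; ∧-zeroʳ; not-involutive)
open import Data.Empty using (⊥-elim)
open import Data.Fin using (_≟_) renaming (zero to fz; suc to fs)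
open import Data.Fin.Properties using (all?; ¬∀⟶∃¬)
open import Data.Fin.Subset using (Subset; ⊤)
open import Data.Nat using (suc; zero; _≤_; z≤n; s≤s)
open import Data.Nat.Properties
  using (+-identityʳ; +-comm; +-mono-≤; ≤-trans; ≤-refl; ≤-reflexive; n≤1+n; +-commutativeSemigroup)
open import Algebra.Properties.CommutativeSemigroup +-commutativeSemigroup using (interchange)
open import Data.Product using (_,_; ∃; proj₁; proj₂)
open import Data.Sum using (inj₁; inj₂; [_,_]) renaming (map to ⊎-map)
open import Data.Unit using (tt)
open import Data.Vec using (_∷_; []; lookup)
open import Function using (id)
open import Function.Bundles using (Equivalence)
open import Relation.Nullary using (Dec; yes; no)
open import Relation.Nullary.Decidable using (_⊎-dec_; _→-dec_; T?; toWitness; decidable-stable)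
open import Relation.Binary.PropositionalEquality using (refl; sym; trans; cong; cong₂; subst)

open Equivalence using (to; from)

T-cong : ∀ {a b} → (T a → T b) → (T b → T a) → a ≡ b
T-cong {true}  {true}  _ _ = refl
T-cong {true}  {false} f _ = ⊥-elim (f tt)
T-cong {false} {true}  _ g = ⊥-elim (g tt)
T-cong {false} {false} _ _ = refl

not-T : ∀ {a} → ¬ T a → T (not a)
not-T {true}  ¬a = ¬a tt
not-T {false} _  = tt

∧-map : ∀ {a a′ b b′} → (T a → T a′) → (T b → T b′) → T (a ∧ b) → T (a′ ∧ b′)
∧-map f g t = from T-∧ (f (proj₁ (to T-∧ t)) , g (proj₂ (to T-∧ t)))

∧₃-intro : ∀ {a b c} → T a → T b → T c → T (a ∧ (b ∧ c))
∧₃-intro {true} {true} ta tb tc = tc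

∧₃-elim : ∀ {a b c} → T (a ∧ (b ∧ c)) → T a × T b × T c
∧₃-elim {true} {true} tc = tt , tt , tc

T-implies : ∀ a b c → T (not (a ∧ b) ∨ c) → T a → T b → T c
T-implies true true c t _ _ = t

implies-T : ∀ a b c → (T a → T b → T c) → T (not (a ∧ b) ∨ c)
implies-T true  true  c h = h tt tt
implies-T true  false c h = tt
implies-T false b     c h = tt

any-intro : ∀ {n} (f : Fin n → Bool) i → T (f i) → T (anyFin f)
any-intro f fz     t = from T-∨ (inj₁ t)
any-intro f (fs i) t = from T-∨ (inj₂ (any-intro (λ j → f (fs j)) i t))

any-mono : ∀ {n} {f g : Fin n → Bool} → (∀ i → T (f i) → T (g i)) → T (anyFin f) → T (anyFin g)
any-mono {suc n} {f} h t with to (T-∨ {f fz}) t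
... | inj₁ t₀ = from T-∨ (inj₁ (h fz t₀))
... | inj₂ ts = from T-∨ (inj₂ (any-mono (λ i → h (fs i)) ts))

all-intro : ∀ {n} (f : Fin n → Bool) → (∀ i → T (f i)) → T (allFin f)
all-intro {zero}  f h = tt
all-intro {suc n} f h = from T-∧ (h fz , all-intro (λ j → f (fs j)) (λ j → h (fs j)))

all-elim : ∀ {n} (f : Fin n → Bool) → T (allFin f) → ∀ i → T (f i)
all-elim {suc n} f t fz     = proj₁ (to (T-∧ {f fz}) t)
all-elim {suc n} f t (fs i) = all-elim (λ j → f (fs j)) (proj₂ (to (T-∧ {f fz}) t)) i

≢⇒==false : ∀ {n} {x y : Fin n} → x ≢ y → (x == y) ≡ false
≢⇒==false {x = x} {y} x≢y with x ≟ y
... | yes x≡y = ⊥-elim (x≢y x≡y)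
... | no  _   = refl

two≤order : ∀ {n} {x y : Fin n} → x ≢ y → 2 ≤ n
two≤order {suc zero}    {fz} {fz} x≢y = ⊥-elim (x≢y refl)
two≤order {suc (suc n)}           _   = s≤s (s≤s z≤n)

three≤order-or-pair : ∀ {n} {x y : Fin n} → x ≢ y → 3 ≤ n ⊎ (∀ a → a ≡ x ⊎ a ≡ y)
three≤order-or-pair {suc zero} {fz} {fz} x≢y = ⊥-elim (x≢y refl)
three≤order-or-pair {suc (suc zero)} {fz} {fz} x≢y = ⊥-elim (x≢y refl)
three≤order-or-pair {suc (suc zero)} {fs fz} {fs fz} x≢y = ⊥-elim (x≢y refl)
three≤order-or-pair {suc (suc zero)} {fz} {fs fz} _ = inj₂ λ { fz → inj₁ refl ; (fs fz) → inj₂ refl }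
three≤order-or-pair {suc (suc zero)} {fs fz} {fz} _ = inj₂ λ { fz → inj₂ refl ; (fs fz) → inj₁ refl }
three≤order-or-pair {suc (suc (suc n))} _ = inj₁ (s≤s (s≤s (s≤s z≤n)))

_⊆_ : ∀ {n} → Subset n → Subset n → Set
S ⊆ S′ = ∀ z → T (lookup S z) → T (lookup S′ z)

⊆-refl : ∀ {n} (S : Subset n) → S ⊆ S
⊆-refl S z = id

lookup-⊤ : ∀ {n} (z : Fin n) → T (lookup (⊤ {n}) z)
lookup-⊤ fz     = tt
lookup-⊤ (fs z) = lookup-⊤ z

⊆-⊤ : ∀ {n} (S : Subset n) → S ⊆ ⊤
⊆-⊤ S z _ = lookup-⊤ z

module Walks {n} (G : Graph n) where

  Near : Fin n → Fin n → Set
  Near a b = a ≡ b ⊎ T (adj G a b)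

  near? : ∀ a b → Dec (Near a b)
  near? a b = (a ≟ b) ⊎-dec T? (adj G a b)

  near-sym : ∀ {a b} → Near a b → Near b a
  near-sym (inj₁ a≡b) = inj₁ (sym a≡b)
  near-sym {a} {b} (inj₂ ab) = inj₂ (subst T (adj-sym G a b) ab)

  adj⇒≢ : ∀ {a b} → T (adj G a b) → a ≢ b
  adj⇒≢ {a} ab refl = subst T (adj-irr G a) ab

  walk-refl : ∀ S k a → T (walkIn G S k a a)
  walk-refl S zero    a = subst T (sym (==-refl a)) tt
  walk-refl S (suc k) a = from T-∨ (inj₁ (subst T (sym (==-refl a)) tt))

  walk-mono : ∀ S S′ {k m} a b → S ⊆ S′ → k ≤ m →
              T (walkIn G S k a b) → T (walkIn G S′ m a b)
  walk-mono S S′ {zero} {m} a b _ _ t with toWitness {a? = a ≟ b} t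
  ... | refl = walk-refl S′ m a
  walk-mono S S′ {suc k} {suc m} a b S⊆S′ (s≤s k≤m) t with to (T-∨ {a == b}) t
  ... | inj₁ a=b  = from T-∨ (inj₁ a=b)
  ... | inj₂ step = from T-∨ (inj₂ (any-mono (λ z →
          ∧-map (S⊆S′ z) (∧-map id (walk-mono S S′ z b S⊆S′ k≤m))) step))

  walk-cons : ∀ S k a c b → T (lookup S c) → T (adj G a c) → T (walkIn G S k c b) →
              T (walkIn G S (suc k) a b)
  walk-cons S k a c b Sc ac w = from T-∨ (inj₂
    (any-intro (λ z → lookup S z ∧ (adj G a z ∧ walkIn G S k z b)) c (from T-∧ (Sc , from T-∧ (ac , w)))))

  near-cons : ∀ S k a c b → T (lookup S c) → Near a c → T (walkIn G S k c b) →
              T (walkIn G S (suc k) a b)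
  near-cons S k a .a b Sc (inj₁ refl) w = walk-mono S S a b (⊆-refl S) (n≤1+n k) w
  near-cons S k a c  b Sc (inj₂ ac)   w = walk-cons S k a c b Sc ac w

  Connected : Subset n → Set
  Connected S = ∀ a b → T (lookup S a) → T (lookup S b) → T (walkIn G S n a b)

  connected-intro : ∀ {S} → Connected S → T (inducedConnected G S)
  connected-intro {S} c = all-intro _ λ a → all-intro _ λ b →
    implies-T (lookup S a) (lookup S b) _ (c a b)

  connected-elim : ∀ {S} → T (inducedConnected G S) → Connected S
  connected-elim {S} t a b = T-implies (lookup S a) (lookup S b) _ (all-elim _ (all-elim _ t a) b)

  separated⇒disconnected : ∀ {u v} → ¬ SameComponent G u v →
    ∀ S → T (lookup S u) → T (lookup S v) → ¬ T (inducedConnected G S)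
  separated⇒disconnected {u} {v} sep S Su Sv c =
    sep (walk-mono S ⊤ u v (⊆-⊤ S) (≤-refl {n}) (connected-elim c u v Su Sv))

  Endpoint : Fin n → Fin n → Fin n → Set
  Endpoint x y h = h ≡ x ⊎ h ≡ y

  endpoint-in : ∀ S {x y h} → T (lookup S x) → T (lookup S y) → Endpoint x y h → T (lookup S h)
  endpoint-in S Sx Sy (inj₁ refl) = Sx
  endpoint-in S Sx Sy (inj₂ refl) = Sy

  endpoints-near : ∀ {x y a b} → T (adj G x y) → Endpoint x y a → Endpoint x y b → Near a b
  endpoints-near xy (inj₁ refl) (inj₁ refl) = inj₁ refl
  endpoints-near xy (inj₁ refl) (inj₂ refl) = inj₂ xy
  endpoints-near xy (inj₂ refl) (inj₁ refl) = near-sym (inj₂ xy)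
  endpoints-near xy (inj₂ refl) (inj₂ refl) = inj₁ refl

  hub : ∀ {x y w} → Near w x ⊎ Near w y → ∃ λ h → Endpoint x y h × Near w h
  hub {x} (inj₁ w~x) = x , inj₁ refl , w~x
  hub {y = y} (inj₂ w~y) = y , inj₂ refl , w~y

  Dominates : Subset n → Fin n → Fin n → Fin n → Set
  Dominates S x y w = T (lookup S w) → Near w x ⊎ Near w y

  dominates? : ∀ S x y w → Dec (Dominates S x y w)
  dominates? S x y w = T? (lookup S w) →-dec (near? w x ⊎-dec near? w y)

  -- An edge xy of G[S] such that every vertex of S is near x or y makes
  -- G[S] connected: any a, b ∈ S are joined by a walk a - h - h′ - b with
  -- h, h′ ∈ {x, y}; when x, y are the only vertices, a and b are near.
  dominating-edge⇒connected : ∀ {S x y} → T (lookup S x) → T (lookup S y) → T (adj G x y) →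
    (∀ w → Dominates S x y w) → Connected S
  dominating-edge⇒connected {S} {x} {y} Sx Sy xy dominated a b Sa Sb =
    [ via-hubs , directly ] (three≤order-or-pair (adj⇒≢ xy))
    where
    via-hubs : 3 ≤ n → T (walkIn G S n a b)
    via-hubs 3≤n with hub (dominated a Sa) | hub (dominated b Sb)
    ... | ha , ha-end , a~ha | hb , hb-end , b~hb = walk-mono S S a b (⊆-refl S) 3≤n
      (near-cons S 2 a ha b (endpoint-in S Sx Sy ha-end) a~ha
        (near-cons S 1 ha hb b (endpoint-in S Sx Sy hb-end) (endpoints-near xy ha-end hb-end)
          (near-cons S 0 hb b b Sb (near-sym b~hb) (walk-refl S 0 b))))

    directly : (∀ z → Endpoint x y z) → T (walkIn G S n a b)
    directly pair = walk-mono S S a b (⊆-refl S) (≤-trans (s≤s z≤n) (two≤order (adj⇒≢ xy)))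
      (near-cons S 0 a b b Sb (endpoints-near xy (pair a) (pair b)) (walk-refl S 0 b))

Complementary : ∀ {n} → Graph n → Graph n → Set
Complementary G H = ∀ x y → x ≢ y → adj H x y ≡ not (adj G x y)

complementary-sym : ∀ {n} (G H : Graph n) → Complementary G H → Complementary H G
complementary-sym G H G∁H x y x≢y =
  trans (sym (not-involutive (adj G x y))) (cong not (sym (G∁H x y x≢y)))

complement-complementary : ∀ {n} (G : Graph n) → Complementary G (complement G)
complement-complementary G x y x≢y =
  trans (cong (λ b → not (adj G x y) ∧ not b) (≢⇒==false x≢y)) (∧-identityʳ (not (adj G x y)))

module Dichotomy {n} (G H : Graph n) (G∁H : Complementary G H) where
  open Walks G
  private module H = Walks H

  far⇒complement-adj : ∀ {a b} → ¬ Near a b → T (adj H a b)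
  far⇒complement-adj {a} {b} a≁b =
    subst T (sym (G∁H a b (λ a≡b → a≁b (inj₁ a≡b)))) (not-T (λ ab → a≁b (inj₂ ab)))

  -- If G[S] is disconnected, any two vertices of S are joined in H[S]:
  -- directly if they are not adjacent in G, and otherwise through a vertex
  -- near neither of them, which must exist by dominating-edge⇒connected.
  disconnected⇒complement-connected : ∀ S → ¬ T (inducedConnected G S) → H.Connected S
  disconnected⇒complement-connected S disc a b Sa Sb with near? a b
  ... | no a≁b = H.walk-mono S S a b (⊆-refl S) (≤-trans (s≤s z≤n) (two≤order (λ a≡b → a≁b (inj₁ a≡b))))
          (H.walk-cons S 0 a b b Sb (far⇒complement-adj a≁b) (H.walk-refl S 0 b))
  ... | yes (inj₁ refl) = H.walk-refl S n a
  ... | yes (inj₂ ab) with all? (dominates? S a b)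
  ...   | yes dominated = ⊥-elim (disc (connected-intro (dominating-edge⇒connected Sa Sb ab dominated)))
  ...   | no ¬dominated with ¬∀⟶∃¬ n _ (dominates? S a b) ¬dominated
  ...     | w , undominated =
    H.walk-mono S S a b (⊆-refl S) (two≤order (adj⇒≢ ab))
      (H.walk-cons S 1 a w b Sw (far⇒complement-adj (λ a~w → undominated (λ _ → inj₁ (near-sym a~w))))
        (H.walk-cons S 0 w b b Sb (far⇒complement-adj (λ w~b → undominated (λ _ → inj₂ w~b)))
          (H.walk-refl S 0 b)))
    where
    Sw : T (lookup S w)
    Sw = decidable-stable (T? (lookup S w)) (λ ¬Sw → undominated (λ Sw → ⊥-elim (¬Sw Sw)))

  connected-or-complement-connected : ∀ S → T (inducedConnected G S) ⊎ T (inducedConnected H S)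
  connected-or-complement-connected S with T? (inducedConnected G S)
  ... | yes conn = inj₁ conn
  ... | no  disc = inj₂ (H.connected-intro (disconnected⇒complement-connected S disc))

count-ext : ∀ {n} {p q : Subset n → Bool} → (∀ S → p S ≡ q S) → countSubsets p ≡ countSubsets q
count-ext {zero}  p≗q = cong (λ b → if b then 1 else 0) (p≗q [])
count-ext {suc n} p≗q = cong₂ _+_ (count-ext (λ S → p≗q (true ∷ S))) (count-ext (λ S → p≗q (false ∷ S)))

count-cong : ∀ {n} {p q : Subset n → Bool} →
  (∀ S → T (p S) → T (q S)) → (∀ S → T (q S) → T (p S)) → countSubsets p ≡ countSubsets q
count-cong p⇒q q⇒p = count-ext (λ S → T-cong (p⇒q S) (q⇒p S))

count-none : ∀ {n} → countSubsets {n} (λ _ → false) ≡ 0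
count-none {zero}  = refl
count-none {suc n} = cong₂ _+_ (count-none {n}) (count-none {n})

double : ∀ k → 2 ^ k + 2 ^ k ≡ 2 ^ suc k
double k = cong (2 ^ k +_) (sym (+-identityʳ (2 ^ k)))

count-all : ∀ {n} → countSubsets {n} (λ _ → true) ≡ 2 ^ n
count-all {zero}  = refl
count-all {suc n} = trans (cong₂ _+_ (count-all {n}) (count-all {n})) (double n)

Contains : ∀ {n} → Fin n → Fin n → Subset n → Bool
Contains u v S = lookup S u ∧ lookup S v

count-member : ∀ {m} (v : Fin (suc m)) → countSubsets (λ S → lookup S v) ≡ 2 ^ m
count-member {m}     fz     = trans (cong₂ _+_ (count-all {m}) (count-none {m})) (+-identityʳ (2 ^ m))
count-member {suc m} (fs v) = trans (cong₂ _+_ (count-member v) (count-member v)) (double m)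

count-pair : ∀ {n} {u v : Fin n} → u ≢ v → countSubsets (Contains u v) ≡ 2 ^ (n ∸ 2)
count-pair {suc zero} {fz} {fz} u≢v = ⊥-elim (u≢v refl)
count-pair {suc (suc m)} {fz} {fz} u≢v = ⊥-elim (u≢v refl)
count-pair {suc (suc m)} {fz} {fs v} _ =
  trans (cong₂ _+_ (count-member v) (count-none {suc m})) (+-identityʳ (2 ^ m))
count-pair {suc (suc m)} {fs u} {fz} _ = trans
  (cong₂ _+_ (trans (count-ext (λ S → ∧-identityʳ (lookup S u))) (count-member u))
             (trans (count-ext (λ S → ∧-zeroʳ (lookup S u))) (count-none {suc m})))
  (+-identityʳ (2 ^ m))
count-pair {suc (suc zero)} {fs fz} {fs fz} u≢v = ⊥-elim (u≢v refl)
count-pair {suc (suc (suc m))} {fs u} {fs v} u≢v =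
  trans (cong₂ _+_ (count-pair u≢v′) (count-pair u≢v′)) (double m)
  where
  u≢v′ : u ≢ v
  u≢v′ u≡v = u≢v (cong fs u≡v)

indicator-union : ∀ r p q → (T r → T p ⊎ T q) →
  (if r then 1 else 0) ≤ (if p then 1 else 0) + (if q then 1 else 0)
indicator-union false p     q     _ = z≤n
indicator-union true  true  q     _ = s≤s z≤n
indicator-union true  false true  _ = s≤s z≤n
indicator-union true  false false r⇒p∨q = [ (λ ()) , (λ ()) ] (r⇒p∨q tt)

count-union : ∀ {n} (r p q : Subset n → Bool) → (∀ S → T (r S) → T (p S) ⊎ T (q S)) →
  countSubsets r ≤ countSubsets p + countSubsets q
count-union {zero}  r p q cover = indicator-union (r []) (p []) (q []) (cover [])
count-union {suc n} r p q cover = ≤-trans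
  (+-mono-≤ (count-union _ _ _ (λ S → cover (true ∷ S))) (count-union _ _ _ (λ S → cover (false ∷ S))))
  (≤-reflexive (interchange (countSubsets (λ S → p (true ∷ S))) (countSubsets (λ S → q (true ∷ S)))
                            (countSubsets (λ S → p (false ∷ S))) (countSubsets (λ S → q (false ∷ S)))))

module Counts {n} (G H : Graph n) (G∁H : Complementary G H) {u v : Fin n} (u≢v : u ≢ v) where
  open Dichotomy G H G∁H using (connected-or-complement-connected)

  counted : ∀ (K : Graph n) S → T (lookup S u) → T (lookup S v) → T (inducedConnected K S) →
    T (lookup S u ∧ (lookup S v ∧ inducedConnected K S))
  counted K S = ∧₃-intro

  uncounted : ∀ (K : Graph n) S → T (lookup S u ∧ (lookup S v ∧ inducedConnected K S)) →
    T (lookup S u) × T (lookup S v) × T (inducedConnected K S)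
  uncounted K S = ∧₃-elim

  -- Each S ∋ u, v is counted by η(G) or by η(H).
  η-lower-bound : η₂ G u v + η₂ H u v ≥ 2 ^ (n ∸ 2)
  η-lower-bound = subst (_≤ η₂ G u v + η₂ H u v) (count-pair u≢v)
    (count-union (Contains u v) _ _ λ S uv∈S →
      let (u∈S , v∈S) = to (T-∧ {lookup S u}) uv∈S
      in ⊎-map (counted G S u∈S v∈S) (counted H S u∈S v∈S) (connected-or-complement-connected S))

  -- If no G[S] with u, v ∈ S is connected, all the corresponding H[S]
  -- are, so η(G) = 0 and η(H) = 2^(n-2).
  η-extremal : (∀ S → T (lookup S u) → T (lookup S v) → ¬ T (inducedConnected G S)) →
    η₂ G u v + η₂ H u v ≡ 2 ^ (n ∸ 2)
  η-extremal disc = cong₂ _+_ η-G η-H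
    where
    η-G : η₂ G u v ≡ 0
    η-G = trans (count-cong (λ S t → let (u∈S , v∈S , conn) = uncounted G S t in disc S u∈S v∈S conn)
                            (λ S ()))
                (count-none {n})

    complement-connected : ∀ S → T (lookup S u) → T (lookup S v) → T (inducedConnected H S)
    complement-connected S u∈S v∈S with connected-or-complement-connected S
    ... | inj₁ G-conn = ⊥-elim (disc S u∈S v∈S G-conn)
    ... | inj₂ H-conn = H-conn

    η-H : η₂ H u v ≡ 2 ^ (n ∸ 2)
    η-H = trans (count-cong (λ S t → let (u∈S , v∈S , _) = uncounted H S t in from T-∧ (u∈S , v∈S))
                            (λ S t → let (u∈S , v∈S) = to (T-∧ {lookup S u}) t
                                     in counted H S u∈S v∈S (complement-connected S u∈S v∈S)))
                (count-pair u≢v)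

lemma1 : (n : ℕ) (G : Graph n) (u v : Fin n) → u ≢ v →
    (η₂ G u v + η₂ (complement G) u v ≥ 2 ^ (n ∸ 2))
    × ((¬ SameComponent G u v ⊎ ¬ SameComponent (complement G) u v) →
       η₂ G u v + η₂ (complement G) u v ≡ 2 ^ (n ∸ 2))
lemma1 n G u v u≢v = G-bound.η-lower-bound , attained
  where
  G∁Ḡ : Complementary G (complement G)
  G∁Ḡ = complement-complementary G

  module G-bound = Counts G (complement G) G∁Ḡ u≢v
  module Ḡ-bound = Counts (complement G) G (complementary-sym G (complement G) G∁Ḡ) u≢v

  attained : ¬ SameComponent G u v ⊎ ¬ SameComponent (complement G) u v →
    η₂ G u v + η₂ (complement G) u v ≡ 2 ^ (n ∸ 2)
  attained (inj₁ G-separates) =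
    G-bound.η-extremal (Walks.separated⇒disconnected G G-separates)
  attained (inj₂ Ḡ-separates) =
    trans (+-comm (η₂ G u v) (η₂ (complement G) u v))
          (Ḡ-bound.η-extremal (Walks.separated⇒disconnected (complement G) Ḡ-separates))
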